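{- Suppose that $\mathcal P_1(S_n) \subseteq \mathcal D^{\mathrm{op}}$, that $p_i = 3$ for some $i \in S_n$, and that there exists $j \in S_n \setminus \{1, i\}$ such that $\{j\} \in \mathcal D$ and $\varepsilon_j = \varepsilon_{ -j} = 1$. Then $i = 2$, $p_1 = 2$, and $\varepsilon_{ -1} = -1$.
   Context: Standing setting: $n \ge 3$ is an integer, $S_n = \{1,\ldots,n\}$; for a set $X$, $\mathcal P_\star(X)$ is the family of finite nonempty proper subsets of $X$ and $\mathcal P_k(X)$ the family of $k$-element subsets. Let $p_1 < p_2 < \cdots < p_n$ be primes, $\mathfrak P = \{p_1,\ldots,p_n\}$, $v_1,\ldots,v_n$ positive integers, $\mathcal D$ a nonempty subfamily of $\mathcal P_\star(S_n)$, and $\varepsilon:\mathcal P_\star(S_n)\to\{\pm1\}$ a map, with $\varepsilon_I := \varepsilon(I)$. Standing hypothesis: every prime $q$ dividing $\prod_{i\in I} p_i^{v_i} - \varepsilon_I$ for some $I \in \mathcal D$ belongs to $\mathfrak P$. Notation: $\mathcal D^{\mathrm{op}} := \{S_n\setminus I : I \in \mathcal D\}$; for $k \in S_n$, $\varepsilon_k := \varepsilon(\{k\})$ and $\varepsilon_{ -k} := \varepsilon(S_n\setminus\{k\})$. -}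

module Defs where

open import Data.Nat using (ℕ; zero; suc; _*_; _^_)
open import Data.Fin using (Fin)
import Data.Fin as F
open import Data.Fin.Subset using (Subset)
open import Data.Vec using (lookup)
open import Data.Bool using (if_then_else_)
open import Data.Sign using (Sign)
open import Data.Integer using (ℤ; +_; -_; _-_)

∏ : ∀ {n} → (Fin n → ℕ) → ℕ
∏ {zero}  f = 1
∏ {suc n} f = f F.zero * ∏ (λ i → f (F.suc i))

prodPow : ∀ {n} → (Fin n → ℕ) → (Fin n → ℕ) → Subset n → ℕ
prodPow p v I = ∏ (λ i → if lookup I i then p i ^ v i else 1)

signℤ : Sign → ℤ
signℤ Sign.+ = + 1
signℤ Sign.- = - (+ 1)

shifted : ∀ {n} → (Fin n → ℕ) → (Fin n → ℕ) → (Subset n → Sign) → Subset n → ℤ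
shifted p v ε I = + prodPow p v I - signℤ (ε I)

module Submission where

-- Write Π_I for ∏_{i ∈ I} p_i^{v_i}.  The standing hypothesis says that for I ∈ D every prime
-- factor of Π_I − ε_I is one of the p_k.  When ε_I = +1 such a factor is coprime to Π_I, so it
-- is a p_k with k ∉ I.  Since S∖{k} ∈ D for every k, three consequences follow.
--   * Some p_k is 2 (else Π_I − 1 is even with no admissible factor 2), so p_1 = 2, the prime 3
--     is p_2, and p_j > 3.  (In Agda the indices are Fin n, starting at zero.)
--   * ε_{-j} = +1 gives Π_{S∖{j}} = p_j^e + 1; together with ε_j = +1 this forces every odd prime
--     factor s of p_j − 1 to divide p_j^{v_j} − 1, hence Π_{S∖{j}} ≡ 2 (mod s), absurd: so p_j is
--     a Fermat prime 2^a + 1 with a even.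
--   * If ε_{-1} were +1 then Π_{S∖{1}} = 2^f + 1 would be divisible by 3 and by p_j.  But
--     3 ∣ 2^f + 1 forces f odd, while 2^a + 1 ∣ 2^f + 1 forces a ∣ f, hence f even.

open import Defs
open import Data.Nat
  using (ℕ; zero; suc; _+_; _*_; _∸_; _^_; _≤_; _<_; z≤n; s≤s; NonZero; >-nonZero; nonTrivial⇒n>1; _%_; _/_)
open import Data.Nat.Properties
open import Data.Nat.DivMod using (%-distribˡ-+; %-distribˡ-*; m<n⇒m%n≡m; m%n<n; m≡m%n+[m/n]*n; [m+kn]%n≡m%n)
open import Data.Nat.Divisibility
  using (_∣_; divides; _∣?_; ∣-trans; m∣m*n; n∣m*n; ∣m+n∣m⇒∣n; ∣1⇒≡1; ∣⇒≤; m%n≡0⇒n∣m; n∣m⇒m%n≡0)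
open import Data.Nat.Primality using (Prime; prime?; prime[2]; prime⇒irreducible; prime⇒nonTrivial)
open import Data.Nat.Primality.Factorisation using (factorise; PrimeFactorisation)
open import Data.Nat.ListAction using (product)
open import Data.Nat.Solver using (module +-*-Solver)
open import Data.List using (List; []; _∷_; length)
open import Data.List.Relation.Unary.All using (All; []; _∷_)
open import Data.Fin using (Fin; zero) renaming (_<_ to _<ᶠ_)
import Data.Fin as F
open import Data.Fin.Properties using (any?) renaming (suc-injective to fsuc-injective; 0≢1+n to fzero≢fsuc)
open import Data.Fin.Subset using (Subset; Nonempty; ∁; ⁅_⁆; _∈_; _∉_)
open import Data.Fin.Subset.Properties using (x∈⁅x⁆; x∈⁅y⁆⇒x≡y; x≢y⇒x∉⁅y⁆; x∉∁p⇒x∈p; x∉p⇒x∈∁p)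
open import Data.Vec using (lookup)
open import Data.Vec.Properties using ([]=⇒lookup; lookup⇒[]=; map-∘; map-cong; map-id)
open import Data.Bool using (true; false; if_then_else_)
open import Data.Bool.Properties using (not-involutive)
open import Data.Sign using (Sign)
open import Data.Integer using (+_)
import Data.Integer.Divisibility as ℤ
open import Data.Product using (∃; _×_; _,_; proj₁; proj₂; map₂)
open import Data.Sum using (_⊎_; inj₁; inj₂)
open import Data.Empty using (⊥; ⊥-elim)
open import Relation.Nullary using (¬_; yes; no)
open import Relation.Nullary.Decidable using (from-yes)
open import Relation.Binary.PropositionalEquality

%-cong-*ˡ : ∀ x {y z} r .{{_ : NonZero r}} → y % r ≡ z % r → (x * y) % r ≡ (x * z) % r
%-cong-*ˡ x {y} {z} r y≡z = begin
  (x * y) % r             ≡⟨ %-distribˡ-* x y r ⟩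
  (x % r * (y % r)) % r   ≡⟨ cong (λ w → (x % r * w) % r) y≡z ⟩
  (x % r * (z % r)) % r   ≡⟨ sym (%-distribˡ-* x z r) ⟩
  (x * z) % r             ∎
  where open ≡-Reasoning

%-cong-+ʳ : ∀ {x y} c r .{{_ : NonZero r}} → x % r ≡ y % r → (x + c) % r ≡ (y + c) % r
%-cong-+ʳ {x} {y} c r x≡y = begin
  (x + c) % r             ≡⟨ %-distribˡ-+ x c r ⟩
  (x % r + c % r) % r     ≡⟨ cong (λ w → (w + c % r) % r) x≡y ⟩
  (y % r + c % r) % r     ≡⟨ sym (%-distribˡ-+ y c r) ⟩
  (y + c) % r             ∎
  where open ≡-Reasoning

*-%-one : ∀ x y r .{{_ : NonZero r}} → 1 < r → x % r ≡ 1 → y % r ≡ 1 → (x * y) % r ≡ 1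
*-%-one x y r 1<r x≡1 y≡1 = begin
  (x * y) % r             ≡⟨ %-distribˡ-* x y r ⟩
  (x % r * (y % r)) % r   ≡⟨ cong₂ (λ a b → (a * b) % r) x≡1 y≡1 ⟩
  1 % r                   ≡⟨ m<n⇒m%n≡m 1<r ⟩
  1                       ∎
  where open ≡-Reasoning

^-%-one : ∀ x r .{{_ : NonZero r}} → 1 < r → x % r ≡ 1 → ∀ t → x ^ t % r ≡ 1
^-%-one x r 1<r x≡1 zero    = m<n⇒m%n≡m 1<r
^-%-one x r 1<r x≡1 (suc t) = *-%-one x (x ^ t) r 1<r x≡1 (^-%-one x r 1<r x≡1 t)

^-alternates : ∀ X q .{{_ : NonZero q}} → 1 < q → (X * X) % q ≡ 1 →
               ∀ k → X ^ k % q ≡ 1 ⊎ X ^ k % q ≡ X % q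
^-alternates X q 1<q X²≡1 zero = inj₁ (m<n⇒m%n≡m 1<q)
^-alternates X q 1<q X²≡1 (suc k) with ^-alternates X q 1<q X²≡1 k
... | inj₁ Xᵏ≡1 = inj₂ (trans (%-cong-*ˡ X q (trans Xᵏ≡1 (sym (m<n⇒m%n≡m 1<q)))) (cong (_% q) (*-identityʳ X)))
... | inj₂ Xᵏ≡X = inj₁ (trans (%-cong-*ˡ X q Xᵏ≡X) X²≡1)

%≡1⇒∣∸1 : ∀ x s .{{_ : NonZero s}} → x % s ≡ 1 → s ∣ x ∸ 1
%≡1⇒∣∸1 x s x≡1 = divides (x / s) (cong (_∸ 1) (trans (m≡m%n+[m/n]*n x s) (cong (_+ x / s * s) x≡1)))

∣∸1⇒%≡1 : ∀ x s .{{_ : NonZero s}} → 1 < s → 0 < x → s ∣ x ∸ 1 → x % s ≡ 1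
∣∸1⇒%≡1 (suc x) s 1<s _ (divides k x≡ks) = begin
  suc x % s               ≡⟨ cong (λ w → suc w % s) x≡ks ⟩
  (1 + k * s) % s         ≡⟨ [m+kn]%n≡m%n 1 k s ⟩
  1 % s                   ≡⟨ m<n⇒m%n≡m 1<s ⟩
  1                       ∎
  where open ≡-Reasoning

∸1≡⇒≡+1 : ∀ {x y} → 0 < x → x ∸ 1 ≡ y → x ≡ y + 1
∸1≡⇒≡+1 {suc x} _ x≡y = trans (+-comm 1 x) (cong (_+ 1) x≡y)

prime⇒>1 : ∀ {s} → Prime s → 1 < s
prime⇒>1 {s} ps = nonTrivial⇒n>1 s {{prime⇒nonTrivial ps}}

-- 2 and 3 are distinct primes dividing 0, which is therefore no prime power.
prime[3] : Prime 3
prime[3] = from-yes (prime? 3)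

∤2⇒%2≡1 : ∀ x → ¬ 2 ∣ x → x % 2 ≡ 1
∤2⇒%2≡1 x 2∤x with x % 2 in x%2≡r | m%n<n x 2
... | 0           | _ = ⊥-elim (2∤x (m%n≡0⇒n∣m x 2 x%2≡r))
... | 1           | _ = refl
... | suc (suc _) | s≤s (s≤s ())

prime-odd : ∀ {s} → Prime s → s ≢ 2 → s % 2 ≡ 1
prime-odd {s} ps s≢2 = ∤2⇒%2≡1 s 2∤s
  where
  2∤s : ¬ 2 ∣ s
  2∤s 2∣s with prime⇒irreducible ps 2∣s
  ... | inj₁ ()
  ... | inj₂ 2≡s = s≢2 (sym 2≡s)

prime∤consecutive : ∀ {s x} → Prime s → 0 < x → s ∣ x → s ∣ x ∸ 1 → ⊥
prime∤consecutive {s} {suc x} ps _ s∣1+x s∣x =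
  >⇒≢ (prime⇒>1 ps) (∣1⇒≡1 (∣m+n∣m⇒∣n (subst (s ∣_) (+-comm 1 x) s∣1+x) s∣x))

product-of-copies : ∀ x (ss : List ℕ) → All Prime ss → (∀ s → Prime s → s ∣ product ss → s ≡ x) →
                    product ss ≡ x ^ length ss
product-of-copies x []       []         _ = refl
product-of-copies x (s ∷ ss) (ps ∷ pss) h = cong₂ _*_ (h s ps (m∣m*n _))
  (product-of-copies x ss pss (λ t pt t∣ → h t pt (∣-trans t∣ (n∣m*n s))))

prime-power : ∀ N x → (∀ s → Prime s → s ∣ N → s ≡ x) → ∃ λ e → N ≡ x ^ e
prime-power zero x h with trans (h 2 prime[2] (divides 0 refl)) (sym (h 3 prime[3] (divides 0 refl)))
... | ()
prime-power N@(suc _) x h = length factors , trans isFactorisation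
  (product-of-copies x factors factorsPrime (λ s ps s∣ → h s ps (subst (s ∣_) (sym isFactorisation) s∣)))
  where open PrimeFactorisation (factorise N)

-- Powers of two modulo three and modulo Fermat numbers

4^t≡2^[t*2] : ∀ t → 4 ^ t ≡ 2 ^ (t * 2)
4^t≡2^[t*2] t = trans (^-*-assoc 2 2 t) (cong (2 ^_) (*-comm 2 t))

4^t%3≡1 : ∀ t → 4 ^ t % 3 ≡ 1
4^t%3≡1 = ^-%-one 4 3 (s≤s (s≤s z≤n)) refl

3∤2^even+1 : ∀ f → 2 ∣ f → ¬ 3 ∣ 2 ^ f + 1
3∤2^even+1 f (divides t f≡t*2) 3∣ = 0≢1+n (begin
    0                     ≡⟨ sym (n∣m⇒m%n≡0 _ 3 3∣) ⟩
    (2 ^ f + 1) % 3       ≡⟨ cong (λ e → (2 ^ e + 1) % 3) f≡t*2 ⟩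
    (2 ^ (t * 2) + 1) % 3 ≡⟨ cong (λ x → (x + 1) % 3) (sym (4^t≡2^[t*2] t)) ⟩
    (4 ^ t + 1) % 3       ≡⟨ %-cong-+ʳ {4 ^ t} {1} 1 3 (4^t%3≡1 t) ⟩
    2                     ∎)
  where open ≡-Reasoning

3∣2^odd+1 : ∀ t → 3 ∣ 2 ^ (1 + t * 2) + 1
3∣2^odd+1 t = m%n≡0⇒n∣m _ 3 (begin
  (2 * 2 ^ (t * 2) + 1) % 3 ≡⟨ cong (λ x → (2 * x + 1) % 3) (sym (4^t≡2^[t*2] t)) ⟩
  (2 * 4 ^ t + 1) % 3       ≡⟨ %-cong-+ʳ {2 * 4 ^ t} {2} 1 3 (%-cong-*ˡ 2 {4 ^ t} {1} 3 (4^t%3≡1 t)) ⟩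
  0                         ∎)
  where open ≡-Reasoning

-- The exponent of a Fermat prime q = 2^a + 1 > 3 is even, since otherwise 3 ∣ q.
fermat-exponent-even : ∀ a → Prime (2 ^ a + 1) → 3 < 2 ^ a + 1 → 2 ∣ a
fermat-exponent-even a pq 3<q with 2 ∣? a
... | yes 2∣a = 2∣a
... | no  2∤a = ⊥-elim (3∤q (subst (λ e → 3 ∣ 2 ^ e + 1) 1+[a/2]*2≡a (3∣2^odd+1 (a / 2))))
  where
  1+[a/2]*2≡a : 1 + a / 2 * 2 ≡ a
  1+[a/2]*2≡a = sym (trans (m≡m%n+[m/n]*n a 2) (cong (_+ a / 2 * 2) (∤2⇒%2≡1 a 2∤a)))
  3∤q : ¬ 3 ∣ 2 ^ a + 1
  3∤q 3∣q with prime⇒irreducible pq 3∣q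
  ... | inj₁ ()
  ... | inj₂ 3≡q = <-irrefl 3≡q 3<q

square-%-succ : ∀ X .{{_ : NonZero (X + 1)}} → 0 < X → (X * X) % (X + 1) ≡ 1
square-%-succ (suc y) _ = begin
  (suc y * suc y) % q     ≡⟨ cong (_% q) (solve 1 (λ y → (con 1 :+ y) :* (con 1 :+ y)
                              := con 1 :+ y :* ((con 1 :+ y) :+ con 1)) refl y) ⟩
  (1 + y * q) % q         ≡⟨ [m+kn]%n≡m%n 1 y q ⟩
  1 % q                   ≡⟨ m<n⇒m%n≡m (s≤s (m≤n+m 1 y)) ⟩
  1                       ∎
  where
  open ≡-Reasoning
  open +-*-Solver
  q = suc y + 1

-- Y·X + 1 ≡ 1 − Y modulo X + 1, so for 0 < Y ≤ X divisibility forces Y = 1.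
succ-∣-Y*X+1 : ∀ Y X → 0 < Y → Y ≤ X → X + 1 ∣ Y * X + 1 → Y ≡ 1
succ-∣-Y*X+1 (suc zero)    X _ _ _ = refl
succ-∣-Y*X+1 (suc (suc y)) X _ Y≤X q∣ = ⊥-elim (<⇒≱ (≤-trans Y≤X (m≤m+n X 1)) (∣⇒≤ q∣1+y))
  where
  open +-*-Solver
  q∣1+y : X + 1 ∣ suc y
  q∣1+y = ∣m+n∣m⇒∣n (subst (X + 1 ∣_)
    (solve 2 (λ y X → (X :+ con 1) :* (con 2 :+ y) := ((con 2 :+ y) :* X :+ con 1) :+ (con 1 :+ y)) refl y X)
    (m∣m*n (suc (suc y)))) q∣

-- If 2^a + 1 ∣ 2^f + 1 then a ∣ f: write f = s + k·a with s < a; as 2^a ≡ −1, 2^f is ≡ 2^s or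
-- ≡ 2^s · 2^a, and only the second case with s = 0 is compatible with the divisibility.
fermat-divisor⇒∣ : ∀ a f → 0 < a → 2 ^ a + 1 ∣ 2 ^ f + 1 → a ∣ f
fermat-divisor⇒∣ a f 0<a q∣ = conclude (^-alternates X q 1<q (square-%-succ X X>0) k)
  where
  instance
    a≢0 : NonZero a
    a≢0 = >-nonZero 0<a
  X = 2 ^ a
  X>0 : 0 < X
  X>0 = m^n>0 2 a
  q = X + 1
  1<q : 1 < q
  1<q = +-monoˡ-< 1 X>0
  instance
    q≢0 : NonZero q
    q≢0 = >-nonZero (<-trans (s≤s z≤n) 1<q)
  s = f % a
  k = f / a
  2^s<X : 2 ^ s < X
  2^s<X = ^-monoʳ-< 2 (s≤s (s≤s z≤n)) (m%n<n f a)
  f≡s+k*a : f ≡ s + k * a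
  f≡s+k*a = m≡m%n+[m/n]*n f a
  2^f≡2^s*Xᵏ : 2 ^ f ≡ 2 ^ s * X ^ k
  2^f≡2^s*Xᵏ = begin
    2 ^ f                 ≡⟨ cong (2 ^_) f≡s+k*a ⟩
    2 ^ (s + k * a)       ≡⟨ ^-distribˡ-+-* 2 s (k * a) ⟩
    2 ^ s * 2 ^ (k * a)   ≡⟨ cong (λ e → 2 ^ s * 2 ^ e) (*-comm k a) ⟩
    2 ^ s * 2 ^ (a * k)   ≡⟨ cong (2 ^ s *_) (sym (^-*-assoc 2 a k)) ⟩
    2 ^ s * X ^ k         ∎
    where open ≡-Reasoning
  reduce : ∀ Y → X ^ k % q ≡ Y % q → (2 ^ s * Y + 1) % q ≡ 0
  reduce Y Xᵏ≡Y = trans (%-cong-+ʳ 1 q (sym (trans (cong (_% q) 2^f≡2^s*Xᵏ) (%-cong-*ˡ (2 ^ s) q Xᵏ≡Y))))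
                        (n∣m⇒m%n≡0 _ q q∣)
  conclude : X ^ k % q ≡ 1 ⊎ X ^ k % q ≡ X % q → a ∣ f
  conclude (inj₁ Xᵏ≡1) = ⊥-elim (1+n≢0 (begin
    suc (2 ^ s)           ≡⟨ +-comm 1 (2 ^ s) ⟩
    2 ^ s + 1             ≡⟨ sym (m<n⇒m%n≡m (+-monoˡ-< 1 2^s<X)) ⟩
    (2 ^ s + 1) % q       ≡⟨ cong (λ w → (w + 1) % q) (sym (*-identityʳ (2 ^ s))) ⟩
    (2 ^ s * 1 + 1) % q   ≡⟨ reduce 1 (trans Xᵏ≡1 (sym (m<n⇒m%n≡m 1<q))) ⟩
    0                     ∎))
    where open ≡-Reasoning
  conclude (inj₂ Xᵏ≡X) with m^n≡1⇒n≡0∨m≡1 2 s 2^s≡1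
    where
    2^s≡1 : 2 ^ s ≡ 1
    2^s≡1 = succ-∣-Y*X+1 (2 ^ s) X (m^n>0 2 s) (<⇒≤ 2^s<X) (m%n≡0⇒n∣m _ q (reduce X Xᵏ≡X))
  ... | inj₁ s≡0 = divides k (trans f≡s+k*a (cong (_+ k * a) s≡0))
  ... | inj₂ ()

-- A Fermat prime q > 3 and 3 never divide the same number 2^f + 1: the first forces f even
-- (its exponent is even and divides f), the second forces f odd.
fermat-prime-and-three : ∀ a f → Prime (2 ^ a + 1) → 3 < 2 ^ a + 1 → 2 ^ a + 1 ∣ 2 ^ f + 1 → ¬ 3 ∣ 2 ^ f + 1
fermat-prime-and-three zero    f _  (s≤s (s≤s ())) _
fermat-prime-and-three (suc a) f pq 3<q q∣ =
  3∤2^even+1 f (∣-trans (fermat-exponent-even (suc a) pq 3<q) (fermat-divisor⇒∣ (suc a) f (s≤s z≤n) q∣))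

∏-∣ : ∀ {n} (f : Fin n → ℕ) (k : Fin n) → f k ∣ ∏ f
∏-∣ f zero      = m∣m*n _
∏-∣ f (F.suc k) = ∣-trans (∏-∣ (λ i → f (F.suc i)) k) (n∣m*n (f zero))

∏-pos : ∀ {n} (f : Fin n → ℕ) → (∀ k → 0 < f k) → 0 < ∏ f
∏-pos {zero}  f _ = s≤s z≤n
∏-pos {suc n} f h = *-mono-≤ (h zero) (∏-pos (λ i → f (F.suc i)) (λ k → h (F.suc k)))

∏-%-one : ∀ {n} (f : Fin n → ℕ) r .{{_ : NonZero r}} → 1 < r → (∀ k → f k % r ≡ 1) → ∏ f % r ≡ 1
∏-%-one {zero}  f r 1<r _ = m<n⇒m%n≡m 1<r
∏-%-one {suc n} f r 1<r h =
  *-%-one (f zero) _ r 1<r (h zero) (∏-%-one (λ i → f (F.suc i)) r 1<r (λ k → h (F.suc k)))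

∏-single : ∀ {n} (f : Fin n → ℕ) (j : Fin n) → (∀ k → k ≢ j → f k ≡ 1) → ∏ f ≡ f j
∏-single {suc n} f zero h = trans (cong (f zero *_) (∏-ones n (λ k → h (F.suc k) (λ ())))) (*-identityʳ _)
  where
  ∏-ones : ∀ m {g : Fin m → ℕ} → (∀ k → g k ≡ 1) → ∏ g ≡ 1
  ∏-ones zero    _  = refl
  ∏-ones (suc m) g≡1 rewrite g≡1 zero = trans (+-identityʳ _) (∏-ones m (λ k → g≡1 (F.suc k)))
∏-single {suc n} f (F.suc j) h rewrite h zero (λ ()) =
  trans (+-identityʳ _) (∏-single (λ i → f (F.suc i)) j (λ k k≢j → h (F.suc k) (λ e → k≢j (fsuc-injective e))))

-- Complementation of subsets is an involution; needed to turn the hypothesis ∁ I ≡ {k} into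
-- I ≡ S∖{k}.
∁-involutive : ∀ {n} (I : Subset n) → ∁ (∁ I) ≡ I
∁-involutive I = trans (sym (map-∘ _ _ I)) (trans (map-cong not-involutive I) (map-id I))

∉⇒lookup≡false : ∀ {n} {I : Subset n} {k : Fin n} → k ∉ I → lookup I k ≡ false
∉⇒lookup≡false {I = I} {k} k∉I with lookup I k in e
... | false = refl
... | true  = ⊥-elim (k∉I (lookup⇒[]= k I e))

module _ {n} (p v : Fin n → ℕ) where

  factor : Subset n → Fin n → ℕ
  factor I k = if lookup I k then p k ^ v k else 1

  prodPow-⁅⁆ : ∀ j → prodPow p v ⁅ j ⁆ ≡ p j ^ v j
  prodPow-⁅⁆ j = trans (∏-single (factor ⁅ j ⁆) j outside)
                       (cong (λ b → if b then p j ^ v j else 1) ([]=⇒lookup (x∈⁅x⁆ j)))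
    where
    outside : ∀ k → k ≢ j → factor ⁅ j ⁆ k ≡ 1
    outside k k≢j rewrite ∉⇒lookup≡false (x≢y⇒x∉⁅y⁆ k≢j) = refl

  prime∈I⇒∣prodPow : ∀ {I k} → k ∈ I → 0 < v k → p k ∣ prodPow p v I
  prime∈I⇒∣prodPow {I} {k} k∈I 0<v = ∣-trans (p∣p^v (v k) 0<v)
    (subst (λ b → (if b then p k ^ v k else 1) ∣ prodPow p v I) ([]=⇒lookup k∈I) (∏-∣ (factor I) k))
    where
    p∣p^v : ∀ w → 0 < w → p k ∣ p k ^ w
    p∣p^v (suc w) _ = m∣m*n _

  prodPow-pos : (∀ k → 0 < p k) → ∀ I → 0 < prodPow p v I
  prodPow-pos p>0 I = ∏-pos (factor I) (λ k → factor-pos k (lookup I k))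
    where
    factor-pos : ∀ k b → 0 < (if b then p k ^ v k else 1)
    factor-pos k true  = m^n>0 (p k) {{>-nonZero (p>0 k)}} (v k)
    factor-pos k false = s≤s z≤n

  prodPow-%-one : ∀ r .{{_ : NonZero r}} → 1 < r → (∀ k → p k % r ≡ 1) → ∀ I → prodPow p v I % r ≡ 1
  prodPow-%-one r 1<r p≡1 I = ∏-%-one (factor I) r 1<r (λ k → factor-%-one k (lookup I k))
    where
    factor-%-one : ∀ k b → (if b then p k ^ v k else 1) % r ≡ 1
    factor-%-one k true  = ^-%-one (p k) r 1<r (p≡1 k) (v k)
    factor-%-one k false = m<n⇒m%n≡m 1<r

  -- For ε_I = +1, the integer Π_I − ε_I is Π_I − 1.
  shifted-plus : (ε : Subset n → Sign) (I : Subset n) → ε I ≡ Sign.+ → 0 < prodPow p v I →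
                 ∀ s → s ∣ prodPow p v I ∸ 1 → (+ s) ℤ.∣ shifted p v ε I
  shifted-plus ε I εI≡+ Π>0 s s∣ rewrite εI≡+ with prodPow p v I | Π>0
  ... | suc _ | _ = s∣

-- Consequences of the standing hypothesis

module Setting {n} (p v : Fin n → ℕ) (D : Subset n → Set) (ε : Subset n → Sign)
  (p-prime : ∀ k → Prime (p k)) (v-pos : ∀ k → 0 < v k)
  (closed : ∀ I → D I → ∀ q → Prime q → (+ q) ℤ.∣ shifted p v ε I → ∃ λ k → q ≡ p k) where

  Π : Subset n → ℕ
  Π = prodPow p v

  Π-pos : ∀ I → 0 < Π I
  Π-pos = prodPow-pos p v (λ k → <-trans (s≤s z≤n) (prime⇒>1 (p-prime k)))

  -- For ε_I = +1, a prime factor of Π_I − 1 is coprime to Π_I, so it is a p_k with k ∉ I.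
  factor-outside : ∀ {I s} → D I → ε I ≡ Sign.+ → Prime s → s ∣ Π I ∸ 1 → ∃ λ k → s ≡ p k × k ∉ I
  factor-outside {I} {s} dI εI≡+ ps s∣ with closed I dI s ps (shifted-plus p v ε I εI≡+ (Π-pos I) s s∣)
  ... | k , s≡pk = k , s≡pk , λ k∈I →
    prime∤consecutive ps (Π-pos I) (subst (_∣ Π I) (sym s≡pk) (prime∈I⇒∣prodPow p v k∈I (v-pos k))) s∣

  -- Some p_k is 2: otherwise every Π_I is odd and 2 ∣ Π_I − 1.
  two-is-among : ∀ {I} → D I → ε I ≡ Sign.+ → ∃ λ k → p k ≡ 2
  two-is-among {I} dI εI≡+ with any? (λ k → p k ≟ 2)
  ... | yes found = found
  ... | no  none  = ⊥-elim (none (k , sym 2≡pk))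
    where
    Π-odd : Π I % 2 ≡ 1
    Π-odd = prodPow-%-one p v 2 (s≤s (s≤s z≤n)) (λ k → prime-odd (p-prime k) (λ pk≡2 → none (k , pk≡2))) I
    outside-factor : ∃ λ k → 2 ≡ p k × k ∉ I
    outside-factor = factor-outside dI εI≡+ prime[2] (%≡1⇒∣∸1 (Π I) 2 Π-odd)
    k = proj₁ outside-factor
    2≡pk = proj₁ (proj₂ outside-factor)

  -- For I = S∖{j} only p_j is admissible, so Π_{S∖{j}} = p_j^e + 1.
  co-singleton-power : ∀ j → D (∁ ⁅ j ⁆) → ε (∁ ⁅ j ⁆) ≡ Sign.+ → ∃ λ e → Π (∁ ⁅ j ⁆) ≡ p j ^ e + 1
  co-singleton-power j d∁ ε∁≡+ = map₂ (∸1≡⇒≡+1 (Π-pos (∁ ⁅ j ⁆))) (prime-power (Π (∁ ⁅ j ⁆) ∸ 1) (p j) only-pj)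
    where
    only-pj : ∀ s → Prime s → s ∣ Π (∁ ⁅ j ⁆) ∸ 1 → s ≡ p j
    only-pj s ps s∣ with factor-outside d∁ ε∁≡+ ps s∣
    ... | k , s≡pk , k∉ = trans s≡pk (cong p (x∈⁅y⁆⇒x≡y j (x∉∁p⇒x∈p k∉)))

  -- If moreover {j} ∈ D with ε_j = +1, then p_j − 1 has no odd prime factor s: such an s would
  -- divide p_j^{v_j} − 1, hence be some p_k with k ≠ j and divide Π_{S∖{j}} = p_j^e + 1 ≡ 2 (mod s).
  no-odd-factor : ∀ j → D ⁅ j ⁆ → ε ⁅ j ⁆ ≡ Sign.+ → D (∁ ⁅ j ⁆) → ε (∁ ⁅ j ⁆) ≡ Sign.+ →
                  ∀ {s} → Prime s → s ≢ 2 → ¬ s ∣ p j ∸ 1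
  no-odd-factor j d⁅j⁆ ε⁅j⁆≡+ d∁ ε∁≡+ {s} ps s≢2 s∣ = Π≢0 (factor-outside d⁅j⁆ ε⁅j⁆≡+ ps s∣pjᵛ∸1)
    where
    instance
      s≢0 : NonZero s
      s≢0 = >-nonZero (<-trans (s≤s z≤n) (prime⇒>1 ps))
    1<s : 1 < s
    1<s = prime⇒>1 ps
    2<s : 2 < s
    2<s = ≤∧≢⇒< 1<s (λ 2≡s → s≢2 (sym 2≡s))
    pj≡1 : p j % s ≡ 1
    pj≡1 = ∣∸1⇒%≡1 (p j) s 1<s (<-trans (s≤s z≤n) (prime⇒>1 (p-prime j))) s∣
    s∣pjᵛ∸1 : s ∣ Π ⁅ j ⁆ ∸ 1
    s∣pjᵛ∸1 = subst (λ x → s ∣ x ∸ 1) (sym (prodPow-⁅⁆ p v j)) (%≡1⇒∣∸1 _ s (^-%-one (p j) s 1<s pj≡1 (v j)))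
    e = proj₁ (co-singleton-power j d∁ ε∁≡+)
    Π≡ = proj₂ (co-singleton-power j d∁ ε∁≡+)
    Π%s≡2 : Π (∁ ⁅ j ⁆) % s ≡ 2
    Π%s≡2 = begin
      Π (∁ ⁅ j ⁆) % s           ≡⟨ cong (_% s) Π≡ ⟩
      (p j ^ e + 1) % s         ≡⟨ %-cong-+ʳ 1 s (trans (^-%-one (p j) s 1<s pj≡1 e) (sym (m<n⇒m%n≡m 1<s))) ⟩
      2 % s                     ≡⟨ m<n⇒m%n≡m 2<s ⟩
      2                         ∎
      where open ≡-Reasoning
    Π≢0 : (∃ λ k → s ≡ p k × k ∉ ⁅ j ⁆) → ⊥
    Π≢0 (k , s≡pk , k∉⁅j⁆) = 0≢1+n (trans (sym (n∣m⇒m%n≡0 _ s s∣Π)) Π%s≡2)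
      where
      s∣Π : s ∣ Π (∁ ⁅ j ⁆)
      s∣Π = subst (_∣ Π (∁ ⁅ j ⁆)) (sym s≡pk) (prime∈I⇒∣prodPow p v (x∉p⇒x∈∁p k∉⁅j⁆) (v-pos k))

  fermat : ∀ j → D ⁅ j ⁆ → ε ⁅ j ⁆ ≡ Sign.+ → D (∁ ⁅ j ⁆) → ε (∁ ⁅ j ⁆) ≡ Sign.+ →
           ∃ λ a → p j ≡ 2 ^ a + 1
  fermat j d⁅j⁆ ε⁅j⁆≡+ d∁ ε∁≡+ =
    map₂ (∸1≡⇒≡+1 (<-trans (s≤s z≤n) (prime⇒>1 (p-prime j)))) (prime-power (p j ∸ 1) 2 only-two)
    where
    only-two : ∀ s → Prime s → s ∣ p j ∸ 1 → s ≡ 2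
    only-two s ps s∣ with s ≟ 2
    ... | yes s≡2 = s≡2
    ... | no  s≢2 = ⊥-elim (no-odd-factor j d⁅j⁆ ε⁅j⁆≡+ d∁ ε∁≡+ ps s≢2 s∣)

  -- With p_z = 2, p_i = 3 and j as in fermat with p_j > 3, the sign ε_{-z} cannot be +1:
  -- otherwise Π_{S∖{z}} = 2^f + 1 is divisible by both 3 and the Fermat prime p_j.
  co-two-sign-not-plus : ∀ z i j → p z ≡ 2 → p i ≡ 3 → i ≢ z → j ≢ z → 3 < p j →
                         D ⁅ j ⁆ → ε ⁅ j ⁆ ≡ Sign.+ → D (∁ ⁅ j ⁆) → ε (∁ ⁅ j ⁆) ≡ Sign.+ →
                         D (∁ ⁅ z ⁆) → ε (∁ ⁅ z ⁆) ≡ Sign.+ → ⊥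
  co-two-sign-not-plus z i j pz≡2 pi≡3 i≢z j≢z 3<pj d⁅j⁆ ε⁅j⁆ d∁j ε∁j d∁z ε∁z =
    fermat-prime-and-three a f (subst Prime pj≡ (p-prime j)) (subst (3 <_) pj≡ 3<pj) pj∣ 3∣
    where
    a = proj₁ (fermat j d⁅j⁆ ε⁅j⁆ d∁j ε∁j)
    pj≡ = proj₂ (fermat j d⁅j⁆ ε⁅j⁆ d∁j ε∁j)
    f = proj₁ (co-singleton-power z d∁z ε∁z)
    Π≡ : Π (∁ ⁅ z ⁆) ≡ 2 ^ f + 1
    Π≡ = trans (proj₂ (co-singleton-power z d∁z ε∁z)) (cong (λ x → x ^ f + 1) pz≡2)
    divides-Π : ∀ {k} → k ≢ z → p k ∣ 2 ^ f + 1
    divides-Π k≢z = subst (_ ∣_) Π≡ (prime∈I⇒∣prodPow p v (x∉p⇒x∈∁p (x≢y⇒x∉⁅y⁆ k≢z)) (v-pos _))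
    pj∣ : 2 ^ a + 1 ∣ 2 ^ f + 1
    pj∣ = subst (_∣ 2 ^ f + 1) pj≡ (divides-Π j≢z)
    3∣ : 3 ∣ 2 ^ f + 1
    3∣ = subst (_∣ 2 ^ f + 1) pi≡3 (divides-Π i≢z)

-- Strictly increasing sequences of primes

module _ {n} (p : Fin (suc n) → ℕ) (increasing : ∀ k l → k <ᶠ l → p k < p l) where

  first-is-two : Prime (p zero) → ∀ k → p k ≡ 2 → p zero ≡ 2
  first-is-two p₀-prime k pk≡2 = ≤-antisym (subst (p zero ≤_) pk≡2 (first-least k)) (prime⇒>1 p₀-prime)
    where
    first-least : ∀ k → p zero ≤ p k
    first-least zero      = ≤-refl
    first-least (F.suc k) = <⇒≤ (increasing zero (F.suc k) (s≤s z≤n))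

module _ {n} (p : Fin (suc (suc n)) → ℕ) (increasing : ∀ k l → k <ᶠ l → p k < p l) where

  three-is-second : p zero ≡ 2 → ∀ i → p i ≡ 3 → i ≡ F.suc zero
  three-is-second p₀≡2 zero pi≡3 with trans (sym p₀≡2) pi≡3
  ... | ()
  three-is-second p₀≡2 (F.suc zero) _ = refl
  three-is-second p₀≡2 (F.suc (F.suc k)) pi≡3 = ⊥-elim (<⇒≱ p₁<3 2<p₁)
    where
    2<p₁ : 2 < p (F.suc zero)
    2<p₁ = subst (_< p (F.suc zero)) p₀≡2 (increasing zero (F.suc zero) (s≤s z≤n))
    p₁<3 : p (F.suc zero) < 3
    p₁<3 = subst (p (F.suc zero) <_) pi≡3 (increasing (F.suc zero) (F.suc (F.suc k)) (s≤s (s≤s z≤n)))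

  beyond-second : ∀ j → j ≢ zero → j ≢ F.suc zero → p (F.suc zero) < p j
  beyond-second zero              j≢0 _   = ⊥-elim (j≢0 refl)
  beyond-second (F.suc zero)      _   j≢1 = ⊥-elim (j≢1 refl)
  beyond-second (F.suc (F.suc k)) _   _   = increasing (F.suc zero) (F.suc (F.suc k)) (s≤s (s≤s z≤n))

lemma6 : (m : ℕ)
    → let n = suc (suc (suc m)) in
      (p : Fin n → ℕ) (v : Fin n → ℕ)
      (D : Subset n → Set) (ε : Subset n → Sign)
    → (∀ k → Prime (p k))
    → (∀ k l → k <ᶠ l → p k < p l)
    → (∀ k → 0 < v k)
    → (∀ I → D I → Nonempty I × Nonempty (∁ I))
    → (∃ λ I → D I)
    → (∀ I → D I → ∀ q → Prime q → (+ q) ℤ.∣ shifted p v ε I → ∃ λ k → q ≡ p k)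
    → (∀ k → ∃ λ I → D I × ∁ I ≡ ⁅ k ⁆)
    → (i : Fin n) → p i ≡ 3
    → (j : Fin n) → j ≢ zero → j ≢ i → D ⁅ j ⁆
    → ε ⁅ j ⁆ ≡ Sign.+ → ε (∁ ⁅ j ⁆) ≡ Sign.+
    → (i ≡ F.suc zero) × (p zero ≡ 2) × (ε (∁ ⁅ zero ⁆) ≡ Sign.-)
lemma6 m p v D ε prime increasing v-pos _ _ closed co-singletons i pi≡3 j j≢0 j≢i d⁅j⁆ ε⁅j⁆ ε∁⁅j⁆ =
  i≡1 , p₀≡2 , ε∁⁅0⁆
  where
  open Setting p v D ε prime v-pos closed
  D∁ : ∀ k → D (∁ ⁅ k ⁆)
  D∁ k with co-singletons k
  ... | I , dI , ∁I≡⁅k⁆ = subst D (trans (sym (∁-involutive I)) (cong ∁ ∁I≡⁅k⁆)) dI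
  p₀≡2 : p zero ≡ 2
  p₀≡2 = first-is-two p increasing (prime zero) _ (proj₂ (two-is-among (D∁ j) ε∁⁅j⁆))
  i≡1 : i ≡ F.suc zero
  i≡1 = three-is-second p increasing p₀≡2 i pi≡3
  3<pj : 3 < p j
  3<pj = subst (_< p j) (trans (cong p (sym i≡1)) pi≡3)
                        (beyond-second p increasing j j≢0 (λ j≡1 → j≢i (trans j≡1 (sym i≡1))))
  i≢0 : i ≢ zero
  i≢0 i≡0 = fzero≢fsuc (trans (sym i≡0) i≡1)
  ε∁⁅0⁆ : ε (∁ ⁅ zero ⁆) ≡ Sign.-
  ε∁⁅0⁆ with ε (∁ ⁅ zero ⁆) in ε≡
  ... | Sign.- = refl
  ... | Sign.+ = ⊥-elim (co-two-sign-not-plus zero i j p₀≡2 pi≡3 i≢0 j≢0 3<pj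
                                              d⁅j⁆ ε⁅j⁆ (D∁ j) ε∁⁅j⁆ (D∁ zero) ε≡)
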